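{- Let $A$ be a pseudo-BCI algebra and define $d_{\varphi}:A\to A$ by $d_{\varphi}(x)=\varphi_x=(x\to 1)\rightsquigarrow 1$ for all $x\in A$. Then $d_{\varphi}$ is a type I symmetric derivation on $A$.
   Context: A pseudo-BCI algebra is a structure $(A,\to,\rightsquigarrow,1)$ of type $(2,2,0)$ such that for all $x,y,z\in A$: $(x\to y)\rightsquigarrow[(y\to z)\rightsquigarrow(x\to z)]=1$; $(x\rightsquigarrow y)\to[(y\rightsquigarrow z)\to(x\rightsquigarrow z)]=1$; $1\to x=x$; $1\rightsquigarrow x=x$; and $x\to y=1$, $y\to x=1$ imply $x=y$. Put $x\Cup_1 y=(x\to y)\rightsquigarrow y$ and $x\Cup_2 y=(x\rightsquigarrow y)\to y$. A map $d:A\to A$ is a type I symmetric derivation if $d(x\to y)=(x\to d(y))\Cup_2(y\to d(x))$ and $d(x\rightsquigarrow y)=(x\rightsquigarrow d(y))\Cup_1(y\rightsquigarrow d(x))$ for all $x,y\in A$. -}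

module Defs where

open import Level using (Level; suc)
open import Relation.Binary.PropositionalEquality using (_≡_)
open import Data.Product using (_×_)

record PseudoBCI (a : Level) : Set (suc a) where
  infixr 5 _⇒_ _⇝_
  field
    Carrier : Set a
    _⇒_     : Carrier → Carrier → Carrier
    _⇝_     : Carrier → Carrier → Carrier
    𝟏       : Carrier
    ax1 : ∀ x y z → (x ⇒ y) ⇝ ((y ⇒ z) ⇝ (x ⇒ z)) ≡ 𝟏
    ax2 : ∀ x y z → (x ⇝ y) ⇒ ((y ⇝ z) ⇒ (x ⇝ z)) ≡ 𝟏
    ax3 : ∀ x → 𝟏 ⇒ x ≡ x
    ax4 : ∀ x → 𝟏 ⇝ x ≡ x
    ax5 : ∀ x y → x ⇒ y ≡ 𝟏 → y ⇒ x ≡ 𝟏 → x ≡ y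

  _⋓₁_ : Carrier → Carrier → Carrier
  x ⋓₁ y = (x ⇒ y) ⇝ y

  _⋓₂_ : Carrier → Carrier → Carrier
  x ⋓₂ y = (x ⇝ y) ⇒ y

  IsTypeISymDerivation : (Carrier → Carrier) → Set a
  IsTypeISymDerivation d =
    (∀ x y → d (x ⇒ y) ≡ (x ⇒ d y) ⋓₂ (y ⇒ d x)) ×
    (∀ x y → d (x ⇝ y) ≡ (x ⇝ d y) ⋓₁ (y ⇝ d x))

  dφ : Carrier → Carrier
  dφ x = (x ⇒ 𝟏) ⇝ 𝟏

module Submission where

-- Write x ⁻ for x → 1; it equals x ⇝ 1, and φ_x = x ⁻ ⁻. Negation identifies comparable
-- elements, so every x ⁻ is maximal, and it swaps → and ⇝, so φ is an endomorphism with
-- x ≤ φ_x. Hence x → φ_y lies above the maximal element φ_(x→y) and equals it, and since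
-- a ≤ a ⋓₂ b, the maximal a = φ_(x→y) absorbs a ⋓₂ b.

open import Level using (Level)
open import Defs
open import Relation.Binary.PropositionalEquality
open import Relation.Binary.Bundles using (Poset)
open import Relation.Binary.Structures using (IsPartialOrder)
import Relation.Binary.Reasoning.PartialOrder as PosetReasoning
open import Data.Product using (_,_)

module PseudoBCIProperties {a : Level} (A : PseudoBCI a) where
  open PseudoBCI A

  infix 4 _≤_
  infix 8 _⁻

  _≤_ : Carrier → Carrier → Set a
  x ≤ y = x ⇒ y ≡ 𝟏

  _⁻ : Carrier → Carrier
  x ⁻ = x ⇒ 𝟏

  Maximal : Carrier → Set a
  Maximal m = ∀ {z} → m ≤ z → z ≡ m

  modus-ponens-⇒ : ∀ {x y} → x ⇒ y ≡ 𝟏 → x ≡ 𝟏 → y ≡ 𝟏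
  modus-ponens-⇒ {y = y} x⇒y≡𝟏 refl = trans (sym (ax3 y)) x⇒y≡𝟏

  modus-ponens-⇝ : ∀ {x y} → x ⇝ y ≡ 𝟏 → x ≡ 𝟏 → y ≡ 𝟏
  modus-ponens-⇝ {y = y} x⇝y≡𝟏 refl = trans (sym (ax4 y)) x⇝y≡𝟏

  x≤x⋓₂y : ∀ x y → x ≤ x ⋓₂ y
  x≤x⋓₂y x y = subst₂ (λ p q → p ⇒ ((x ⇝ y) ⇒ q) ≡ 𝟏) (ax4 x) (ax4 y) (ax2 𝟏 x y)

  x⇝x⋓₁y≡𝟏 : ∀ x y → x ⇝ x ⋓₁ y ≡ 𝟏
  x⇝x⋓₁y≡𝟏 x y = subst₂ (λ p q → p ⇝ ((x ⇒ y) ⇝ q) ≡ 𝟏) (ax3 x) (ax3 y) (ax1 𝟏 x y)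

  x⇒x≡𝟏 : ∀ x → x ⇒ x ≡ 𝟏
  x⇒x≡𝟏 x = modus-ponens-⇒ (subst (λ t → 𝟏 ⇒ (t ⇒ x) ≡ 𝟏) (ax4 x) (x≤x⋓₂y 𝟏 x)) refl

  x⇝x≡𝟏 : ∀ x → x ⇝ x ≡ 𝟏
  x⇝x≡𝟏 x = modus-ponens-⇝ (subst (λ t → 𝟏 ⇝ (t ⇝ x) ≡ 𝟏) (ax3 x) (x⇝x⋓₁y≡𝟏 𝟏 x)) refl

  ≤-to-⇝ : ∀ {x y} → x ≤ y → x ⇝ y ≡ 𝟏
  ≤-to-⇝ {x} {y} x≤y = begin
    x ⇝ y         ≡⟨ cong (x ⇝_) (ax4 y) ⟨
    x ⇝ (𝟏 ⇝ y)   ≡⟨ cong (λ t → x ⇝ (t ⇝ y)) x≤y ⟨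
    x ⇝ x ⋓₁ y    ≡⟨ x⇝x⋓₁y≡𝟏 x y ⟩
    𝟏             ∎
    where open ≡-Reasoning

  ≤-from-⇝ : ∀ {x y} → x ⇝ y ≡ 𝟏 → x ≤ y
  ≤-from-⇝ {x} {y} x⇝y≡𝟏 = begin
    x ⇒ y         ≡⟨ cong (x ⇒_) (ax3 y) ⟨
    x ⇒ (𝟏 ⇒ y)   ≡⟨ cong (λ t → x ⇒ (t ⇒ y)) x⇝y≡𝟏 ⟨
    x ⇒ x ⋓₂ y    ≡⟨ x≤x⋓₂y x y ⟩
    𝟏             ∎
    where open ≡-Reasoning

  x≤x⋓₁y : ∀ x y → x ≤ x ⋓₁ y
  x≤x⋓₁y x y = ≤-from-⇝ (x⇝x⋓₁y≡𝟏 x y)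

  ⇒-antitoneˡ : ∀ {x y} z → x ≤ y → y ⇒ z ≤ x ⇒ z
  ⇒-antitoneˡ z x≤y = ≤-from-⇝ (modus-ponens-⇝ (ax1 _ _ z) x≤y)

  ⇝-antitoneˡ : ∀ {x y} z → x ≤ y → y ⇝ z ≤ x ⇝ z
  ⇝-antitoneˡ z x≤y = modus-ponens-⇒ (ax2 _ _ z) (≤-to-⇝ x≤y)

  ≤-trans : ∀ {x y z} → x ≤ y → y ≤ z → x ≤ z
  ≤-trans x≤y y≤z = modus-ponens-⇒ (⇒-antitoneˡ _ x≤y) y≤z

  ≤-isPartialOrder : IsPartialOrder _≡_ _≤_
  ≤-isPartialOrder = record
    { isPreorder = record
      { isEquivalence = isEquivalence
      ; reflexive     = λ { {x} refl → x⇒x≡𝟏 x }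
      ; trans         = ≤-trans
      }
    ; antisym = ax5 _ _
    }

  ≤-poset : Poset a a a
  ≤-poset = record { isPartialOrder = ≤-isPartialOrder }

  open PosetReasoning ≤-poset

  ⇒-⇝-exchange : ∀ x y z → x ⇒ (y ⇝ z) ≡ y ⇝ (x ⇒ z)
  ⇒-⇝-exchange x y z = ax5 _ _ forward backward
    where
    forward : x ⇒ (y ⇝ z) ≤ y ⇝ (x ⇒ z)
    forward = begin
      x ⇒ (y ⇝ z)               ≤⟨ ≤-from-⇝ (ax1 x (y ⇝ z) z) ⟩
      y ⋓₂ z ⇝ (x ⇒ z)          ≤⟨ ⇝-antitoneˡ (x ⇒ z) (x≤x⋓₂y y z) ⟩
      y ⇝ (x ⇒ z)               ∎
    backward : y ⇝ (x ⇒ z) ≤ x ⇒ (y ⇝ z)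
    backward = begin
      y ⇝ (x ⇒ z)               ≤⟨ ax2 y (x ⇒ z) z ⟩
      x ⋓₁ z ⇒ (y ⇝ z)          ≤⟨ ⇒-antitoneˡ (y ⇝ z) (x≤x⋓₁y x z) ⟩
      x ⇒ (y ⇝ z)               ∎

  ≤-⇝-swap : ∀ {x y z} → x ≤ y ⇝ z → y ≤ x ⇒ z
  ≤-⇝-swap {x} {y} {z} x≤y⇝z = ≤-from-⇝ (trans (sym (⇒-⇝-exchange x y z)) x≤y⇝z)

  ≤-⇒-swap : ∀ {x y z} → y ≤ x ⇒ z → x ≤ y ⇝ z
  ≤-⇒-swap {x} {y} {z} y≤x⇒z = trans (⇒-⇝-exchange x y z) (≤-to-⇝ y≤x⇒z)

  ⁻≡⇝𝟏 : ∀ x → x ⁻ ≡ x ⇝ 𝟏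
  ⁻≡⇝𝟏 x = begin-equality
    x ⇒ 𝟏         ≡⟨ cong (x ⇒_) (x⇝x≡𝟏 x) ⟨
    x ⇒ (x ⇝ x)   ≡⟨ ⇒-⇝-exchange x x x ⟩
    x ⇝ (x ⇒ x)   ≡⟨ cong (x ⇝_) (x⇒x≡𝟏 x) ⟩
    x ⇝ 𝟏         ∎

  x⇒[y⇝x]≡y⁻ : ∀ x y → x ⇒ (y ⇝ x) ≡ y ⁻
  x⇒[y⇝x]≡y⁻ x y = begin-equality
    x ⇒ (y ⇝ x)   ≡⟨ ⇒-⇝-exchange x y x ⟩
    y ⇝ (x ⇒ x)   ≡⟨ cong (y ⇝_) (x⇒x≡𝟏 x) ⟩
    y ⇝ 𝟏         ≡⟨ ⁻≡⇝𝟏 y ⟨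
    y ⁻           ∎

  x⇝[y⇒x]≡y⁻ : ∀ x y → x ⇝ (y ⇒ x) ≡ y ⁻
  x⇝[y⇒x]≡y⁻ x y = begin-equality
    x ⇝ (y ⇒ x)   ≡⟨ ⇒-⇝-exchange y x x ⟨
    y ⇒ (x ⇝ x)   ≡⟨ cong (y ⇒_) (x⇝x≡𝟏 x) ⟩
    y ⁻           ∎

  ⁻-invariant-≤ : ∀ {x y} → x ≤ y → y ⁻ ≡ x ⁻
  ⁻-invariant-≤ {x} {y} x≤y = begin-equality
    y ⇒ 𝟏         ≡⟨ cong (y ⇒_) (≤-to-⇝ x≤y) ⟨
    y ⇒ (x ⇝ y)   ≡⟨ x⇒[y⇝x]≡y⁻ y x ⟩
    x ⁻           ∎

  dφ≡⁻⁻ : ∀ x → dφ x ≡ x ⁻ ⁻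
  dφ≡⁻⁻ x = sym (⁻≡⇝𝟏 (x ⁻))

  x≤dφx : ∀ x → x ≤ dφ x
  x≤dφx x = x≤x⋓₁y x 𝟏

  x≤x⁻⁻ : ∀ x → x ≤ x ⁻ ⁻
  x≤x⁻⁻ x = subst (x ≤_) (dφ≡⁻⁻ x) (x≤dφx x)

  ⁻-maximal : ∀ x → Maximal (x ⁻)
  ⁻-maximal x {z} x⁻≤z = ax5 _ _ z≤x⁻ x⁻≤z
    where
    z⁻⁻≡x⁻ : z ⁻ ⁻ ≡ x ⁻
    z⁻⁻≡x⁻ = trans (cong _⁻ (⁻-invariant-≤ x⁻≤z)) (⁻-invariant-≤ (x≤x⁻⁻ x))
    z≤x⁻ : z ≤ x ⁻
    z≤x⁻ = subst (z ≤_) z⁻⁻≡x⁻ (x≤x⁻⁻ z)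

  dφ-maximal : ∀ x → Maximal (dφ x)
  dφ-maximal x = subst Maximal (sym (dφ≡⁻⁻ x)) (⁻-maximal (x ⁻))

  ⇒-contraposition : ∀ x y → x ⇒ y ≤ y ⁻ ⇝ x ⁻
  ⇒-contraposition x y = ≤-from-⇝ (ax1 x y 𝟏)

  ⇝-contraposition : ∀ x y → x ⇝ y ≤ y ⁻ ⇒ x ⁻
  ⇝-contraposition x y =
    subst₂ (λ p q → x ⇝ y ≤ p ⇒ q) (sym (⁻≡⇝𝟏 y)) (sym (⁻≡⇝𝟏 x)) (ax2 x y 𝟏)

  x⇒y≤[y⇒x]⁻ : ∀ x y → x ⇒ y ≤ (y ⇒ x) ⁻
  x⇒y≤[y⇒x]⁻ x y = subst (x ⇒ y ≤_) (sym (⁻≡⇝𝟏 (y ⇒ x)))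
    (≤-from-⇝ (subst (λ t → (x ⇒ y) ⇝ ((y ⇒ x) ⇝ t) ≡ 𝟏) (x⇒x≡𝟏 x) (ax1 x y x)))

  x⇝y≤[y⇝x]⁻ : ∀ x y → x ⇝ y ≤ (y ⇝ x) ⁻
  x⇝y≤[y⇝x]⁻ x y = subst (λ t → x ⇝ y ≤ (y ⇝ x) ⇒ t) (x⇝x≡𝟏 x) (ax2 x y x)

  ⁻-⇒-hom : ∀ x y → (x ⇒ y) ⁻ ≡ x ⁻ ⇝ y ⁻
  ⁻-⇒-hom x y = ax5 _ _ (≤-⇒-swap x⁻≤[x⇒y]⁻⇒y⁻) x⁻⇝y⁻≤[x⇒y]⁻
    where
    x⁻≤[x⇒y]⁻⇒y⁻ : x ⁻ ≤ (x ⇒ y) ⁻ ⇒ y ⁻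
    x⁻≤[x⇒y]⁻⇒y⁻ = begin
      x ⁻              ≡⟨ x⇝[y⇒x]≡y⁻ y x ⟨
      y ⇝ (x ⇒ y)      ≤⟨ ⇝-contraposition y (x ⇒ y) ⟩
      (x ⇒ y) ⁻ ⇒ y ⁻  ∎
    x⁻⇝y⁻≤[x⇒y]⁻ : x ⁻ ⇝ y ⁻ ≤ (x ⇒ y) ⁻
    x⁻⇝y⁻≤[x⇒y]⁻ = begin
      x ⁻ ⇝ y ⁻        ≤⟨ x⇝y≤[y⇝x]⁻ (x ⁻) (y ⁻) ⟩
      (y ⁻ ⇝ x ⁻) ⁻    ≡⟨ ⁻-invariant-≤ (⇒-contraposition x y) ⟩
      (x ⇒ y) ⁻        ∎

  ⁻-⇝-hom : ∀ x y → (x ⇝ y) ⁻ ≡ x ⁻ ⇒ y ⁻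
  ⁻-⇝-hom x y = ax5 _ _ (≤-⇝-swap x⁻≤[x⇝y]⁻⇝y⁻) x⁻⇒y⁻≤[x⇝y]⁻
    where
    x⁻≤[x⇝y]⁻⇝y⁻ : x ⁻ ≤ (x ⇝ y) ⁻ ⇝ y ⁻
    x⁻≤[x⇝y]⁻⇝y⁻ = begin
      x ⁻              ≡⟨ x⇒[y⇝x]≡y⁻ y x ⟨
      y ⇒ (x ⇝ y)      ≤⟨ ⇒-contraposition y (x ⇝ y) ⟩
      (x ⇝ y) ⁻ ⇝ y ⁻  ∎
    x⁻⇒y⁻≤[x⇝y]⁻ : x ⁻ ⇒ y ⁻ ≤ (x ⇝ y) ⁻
    x⁻⇒y⁻≤[x⇝y]⁻ = begin
      x ⁻ ⇒ y ⁻        ≤⟨ x⇒y≤[y⇒x]⁻ (x ⁻) (y ⁻) ⟩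
      (y ⁻ ⇒ x ⁻) ⁻    ≡⟨ ⁻-invariant-≤ (⇝-contraposition x y) ⟩
      (x ⇝ y) ⁻        ∎

  dφ-⇒-hom : ∀ x y → dφ (x ⇒ y) ≡ dφ x ⇒ dφ y
  dφ-⇒-hom x y = begin-equality
    dφ (x ⇒ y)       ≡⟨ dφ≡⁻⁻ (x ⇒ y) ⟩
    (x ⇒ y) ⁻ ⁻      ≡⟨ cong _⁻ (⁻-⇒-hom x y) ⟩
    (x ⁻ ⇝ y ⁻) ⁻    ≡⟨ ⁻-⇝-hom (x ⁻) (y ⁻) ⟩
    x ⁻ ⁻ ⇒ y ⁻ ⁻    ≡⟨ cong₂ _⇒_ (dφ≡⁻⁻ x) (dφ≡⁻⁻ y) ⟨
    dφ x ⇒ dφ y      ∎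

  dφ-⇝-hom : ∀ x y → dφ (x ⇝ y) ≡ dφ x ⇝ dφ y
  dφ-⇝-hom x y = begin-equality
    dφ (x ⇝ y)       ≡⟨ dφ≡⁻⁻ (x ⇝ y) ⟩
    (x ⇝ y) ⁻ ⁻      ≡⟨ cong _⁻ (⁻-⇝-hom x y) ⟩
    (x ⁻ ⇒ y ⁻) ⁻    ≡⟨ ⁻-⇒-hom (x ⁻) (y ⁻) ⟩
    x ⁻ ⁻ ⇝ y ⁻ ⁻    ≡⟨ cong₂ _⇝_ (dφ≡⁻⁻ x) (dφ≡⁻⁻ y) ⟨
    dφ x ⇝ dφ y      ∎

  x⇒dφy≡dφ[x⇒y] : ∀ x y → x ⇒ dφ y ≡ dφ (x ⇒ y)
  x⇒dφy≡dφ[x⇒y] x y = dφ-maximal (x ⇒ y) (begin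
    dφ (x ⇒ y)       ≡⟨ dφ-⇒-hom x y ⟩
    dφ x ⇒ dφ y      ≤⟨ ⇒-antitoneˡ (dφ y) (x≤dφx x) ⟩
    x ⇒ dφ y         ∎)

  x⇝dφy≡dφ[x⇝y] : ∀ x y → x ⇝ dφ y ≡ dφ (x ⇝ y)
  x⇝dφy≡dφ[x⇝y] x y = dφ-maximal (x ⇝ y) (begin
    dφ (x ⇝ y)       ≡⟨ dφ-⇝-hom x y ⟩
    dφ x ⇝ dφ y      ≤⟨ ⇝-antitoneˡ (dφ y) (x≤dφx x) ⟩
    x ⇝ dφ y         ∎)

  dφ-derivation-⇒ : ∀ x y → dφ (x ⇒ y) ≡ (x ⇒ dφ y) ⋓₂ (y ⇒ dφ x)
  dφ-derivation-⇒ x y = begin-equality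
    dφ (x ⇒ y)                  ≡⟨ dφ-maximal (x ⇒ y) (x≤x⋓₂y _ (y ⇒ dφ x)) ⟨
    dφ (x ⇒ y) ⋓₂ (y ⇒ dφ x)   ≡⟨ cong (_⋓₂ (y ⇒ dφ x)) (x⇒dφy≡dφ[x⇒y] x y) ⟨
    (x ⇒ dφ y) ⋓₂ (y ⇒ dφ x)   ∎

  dφ-derivation-⇝ : ∀ x y → dφ (x ⇝ y) ≡ (x ⇝ dφ y) ⋓₁ (y ⇝ dφ x)
  dφ-derivation-⇝ x y = begin-equality
    dφ (x ⇝ y)                  ≡⟨ dφ-maximal (x ⇝ y) (x≤x⋓₁y _ (y ⇝ dφ x)) ⟨
    dφ (x ⇝ y) ⋓₁ (y ⇝ dφ x)   ≡⟨ cong (_⋓₁ (y ⇝ dφ x)) (x⇝dφy≡dφ[x⇝y] x y) ⟨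
    (x ⇝ dφ y) ⋓₁ (y ⇝ dφ x)   ∎

proposition5p7 : ∀ {a : Level} (A : PseudoBCI a) → PseudoBCI.IsTypeISymDerivation A (PseudoBCI.dφ A)
proposition5p7 A = dφ-derivation-⇒ , dφ-derivation-⇝
  where open PseudoBCIProperties A
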